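{- For all terms $q,q'$ the following are equivalent: (1) $q=_{\mathrm{CLC}_0} q'$; (2) $q=_{\mathrm{CLC}} q'$; (3) $q=_{\mathrm{CLC}^+} q'$.
   Context: Terms are built from variables and the constants $C,T,F,K,S$ by binary application, left-associated; rules apply in any context. $\mathrm{CLC}_0$ has rules $C\,T\,x\,y\to x$; $C\,F\,x\,y\to y$; $C\,z\,x\,x\to x$; $K\,x\,y\to x$; $S\,x\,y\,z\to x\,z\,(y\,z)$. $\mathrm{CLC}$ is the conditional system with rules $C\,T\,x\,y\to x$; $C\,F\,x\,y\to y$; $C\,z\,x\,y\to x \Leftarrow x=y$; $K\,x\,y\to x$; $S\,x\,y\,z\to x\,z\,(y\,z)$, where $=$ is convertibility in $\mathrm{CLC}$ itself, defined by levels: $\mathrm{CLC}_{(0)}$ interprets $=$ as the empty relation, $\mathrm{CLC}_{(n+1)}$ interprets $=$ as convertibility of $\mathrm{CLC}_{(n)}$, and $\to_{\mathrm{CLC}}=\bigcup_n\to_{\mathrm{CLC}_{(n)}}$. $\mathrm{CLC}^+$ is defined likewise from the rules of $\mathrm{CLC}$ plus $C\,z\,x\,y\to y\Leftarrow x=y$. For a system $X$, $=_X$ is convertibility (reflexive–symmetric–transitive closure of $\to_X$). -}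

module Defs where

open import Level using () renaming (zero to lzero)
open import Data.Nat using (ℕ; zero; suc)
open import Data.Product using (Σ)
open import Data.Empty using (⊥)
open import Relation.Binary.Core using (Rel)
open import Relation.Binary.Construct.Closure.Equivalence using (EqClosure)

data Term : Set where
  var : ℕ → Term
  C T F K S : Term
  _·_ : Term → Term → Term

infixl 9 _·_
infix 4 _⟶₀_ _⟶CLC_ _⟶CLC⁺_ _=CLC₀_ _=CLC_ _=CLC⁺_

data _⟶₀_ : Term → Term → Set where
  CT   : ∀ x y → C · T · x · y ⟶₀ x
  CF   : ∀ x y → C · F · x · y ⟶₀ y
  Cxx  : ∀ z x → C · z · x · x ⟶₀ x
  Kr   : ∀ x y → K · x · y ⟶₀ x
  Sr   : ∀ x y z → S · x · y · z ⟶₀ x · z · (y · z)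
  appL : ∀ {a b} c → a ⟶₀ b → a · c ⟶₀ b · c
  appR : ∀ {a b} c → a ⟶₀ b → c · a ⟶₀ c · b

-- One-step reduction of CLC relative to an interpretation _≈_ of the
-- condition "=" (the level construction CLC_(n)).
data StepCLC (_≈_ : Rel Term lzero) : Term → Term → Set where
  CT   : ∀ x y → StepCLC _≈_ (C · T · x · y) x
  CF   : ∀ x y → StepCLC _≈_ (C · F · x · y) y
  Ceq  : ∀ z x y → x ≈ y → StepCLC _≈_ (C · z · x · y) x
  Kr   : ∀ x y → StepCLC _≈_ (K · x · y) x
  Sr   : ∀ x y z → StepCLC _≈_ (S · x · y · z) (x · z · (y · z))
  appL : ∀ {a b} c → StepCLC _≈_ a b → StepCLC _≈_ (a · c) (b · c)
  appR : ∀ {a b} c → StepCLC _≈_ a b → StepCLC _≈_ (c · a) (c · b)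

data StepCLC⁺ (_≈_ : Rel Term lzero) : Term → Term → Set where
  CT   : ∀ x y → StepCLC⁺ _≈_ (C · T · x · y) x
  CF   : ∀ x y → StepCLC⁺ _≈_ (C · F · x · y) y
  Ceq  : ∀ z x y → x ≈ y → StepCLC⁺ _≈_ (C · z · x · y) x
  Ceq' : ∀ z x y → x ≈ y → StepCLC⁺ _≈_ (C · z · x · y) y
  Kr   : ∀ x y → StepCLC⁺ _≈_ (K · x · y) x
  Sr   : ∀ x y z → StepCLC⁺ _≈_ (S · x · y · z) (x · z · (y · z))
  appL : ∀ {a b} c → StepCLC⁺ _≈_ a b → StepCLC⁺ _≈_ (a · c) (b · c)
  appR : ∀ {a b} c → StepCLC⁺ _≈_ a b → StepCLC⁺ _≈_ (c · a) (c · b)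

Empty : Rel Term lzero
Empty _ _ = ⊥

⟶CLC[_] : ℕ → Rel Term lzero
⟶CLC[ zero ]  = StepCLC Empty
⟶CLC[ suc n ] = StepCLC (EqClosure ⟶CLC[ n ])

⟶CLC⁺[_] : ℕ → Rel Term lzero
⟶CLC⁺[ zero ]  = StepCLC⁺ Empty
⟶CLC⁺[ suc n ] = StepCLC⁺ (EqClosure ⟶CLC⁺[ n ])

_⟶CLC_ : Rel Term lzero
a ⟶CLC b = Σ ℕ (λ n → ⟶CLC[ n ] a b)

_⟶CLC⁺_ : Rel Term lzero
a ⟶CLC⁺ b = Σ ℕ (λ n → ⟶CLC⁺[ n ] a b)

_=CLC₀_ : Rel Term lzero
_=CLC₀_ = EqClosure _⟶₀_

_=CLC_ : Rel Term lzero
_=CLC_ = EqClosure _⟶CLC_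

_=CLC⁺_ : Rel Term lzero
_=CLC⁺_ = EqClosure _⟶CLC⁺_

-- The inclusions =CLC₀ ⊆ =CLC ⊆ =CLC⁺ ⊆ =CLC₀ close the cycle.  The rule
-- C z x x → x is the conditional rule of CLC at level 1, its condition x = x
-- holding by reflexivity; CLC is a subsystem of CLC⁺ level by level; and, by
-- induction on the level, a conditional step C z x y → x (or → y) with x = y
-- is a CLC₀ conversion, since rewriting y to x (resp. x to y) inside C z x y
-- reaches C z x x (resp. C z y y), which contracts by the unconditional rule.
module Submission where

open import Defs
open import Data.Product using (_×_; _,_)
open import Data.Nat using (zero; suc)
open import Function.Bundles using (_⇔_; mk⇔)
open import Level using () renaming (zero to lzero)
open import Relation.Binary.Core using (Rel; _⇒_)
open import Relation.Binary.Structures using (IsEquivalence)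
open import Relation.Binary.Construct.Closure.Equivalence as EqClosure
  using (EqClosure)

=CLC₀-isEquivalence : IsEquivalence _=CLC₀_
=CLC₀-isEquivalence = EqClosure.isEquivalence _⟶₀_

=CLC₀-trans : ∀ {a b c} → a =CLC₀ b → b =CLC₀ c → a =CLC₀ c
=CLC₀-trans = EqClosure.transitive _⟶₀_

=CLC₀-sym : ∀ {a b} → a =CLC₀ b → b =CLC₀ a
=CLC₀-sym = EqClosure.symmetric _⟶₀_

=CLC₀-congˡ : ∀ {a b} c → a =CLC₀ b → a · c =CLC₀ b · c
=CLC₀-congˡ c = EqClosure.gmap (_· c) (appL c)

=CLC₀-congʳ : ∀ {a b} c → a =CLC₀ b → c · a =CLC₀ c · b
=CLC₀-congʳ c = EqClosure.gmap (c ·_) (appR c)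

StepCLC⁺-sound : ∀ {R : Rel Term lzero} → R ⇒ _=CLC₀_ → StepCLC⁺ R ⇒ _=CLC₀_
StepCLC⁺-sound R⇒= (CT x y)       = EqClosure.return (CT x y)
StepCLC⁺-sound R⇒= (CF x y)       = EqClosure.return (CF x y)
StepCLC⁺-sound R⇒= (Ceq z x y x≈y) =
  =CLC₀-trans (=CLC₀-congʳ (C · z · x) (=CLC₀-sym (R⇒= x≈y)))
              (EqClosure.return (Cxx z x))
StepCLC⁺-sound R⇒= (Ceq' z x y x≈y) =
  =CLC₀-trans (=CLC₀-congˡ y (=CLC₀-congʳ (C · z) (R⇒= x≈y)))
              (EqClosure.return (Cxx z y))
StepCLC⁺-sound R⇒= (Kr x y)       = EqClosure.return (Kr x y)
StepCLC⁺-sound R⇒= (Sr x y z)     = EqClosure.return (Sr x y z)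
StepCLC⁺-sound R⇒= (appL c s)     = =CLC₀-congˡ c (StepCLC⁺-sound R⇒= s)
StepCLC⁺-sound R⇒= (appR c s)     = =CLC₀-congʳ c (StepCLC⁺-sound R⇒= s)

⟶CLC⁺[_]⇒=CLC₀ : ∀ n → ⟶CLC⁺[ n ] ⇒ _=CLC₀_
⟶CLC⁺[ zero ]⇒=CLC₀  = StepCLC⁺-sound (λ ())
⟶CLC⁺[ suc n ]⇒=CLC₀ =
  StepCLC⁺-sound (EqClosure.fold =CLC₀-isEquivalence ⟶CLC⁺[ n ]⇒=CLC₀)

StepCLC⇒StepCLC⁺ : ∀ {R R' : Rel Term lzero} → R ⇒ R' → StepCLC R ⇒ StepCLC⁺ R'
StepCLC⇒StepCLC⁺ R⇒R' (CT x y)        = CT x y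
StepCLC⇒StepCLC⁺ R⇒R' (CF x y)        = CF x y
StepCLC⇒StepCLC⁺ R⇒R' (Ceq z x y x≈y) = Ceq z x y (R⇒R' x≈y)
StepCLC⇒StepCLC⁺ R⇒R' (Kr x y)        = Kr x y
StepCLC⇒StepCLC⁺ R⇒R' (Sr x y z)      = Sr x y z
StepCLC⇒StepCLC⁺ R⇒R' (appL c s)      = appL c (StepCLC⇒StepCLC⁺ R⇒R' s)
StepCLC⇒StepCLC⁺ R⇒R' (appR c s)      = appR c (StepCLC⇒StepCLC⁺ R⇒R' s)

⟶CLC[_]⇒⟶CLC⁺ : ∀ n → ⟶CLC[ n ] ⇒ ⟶CLC⁺[ n ]
⟶CLC[ zero ]⇒⟶CLC⁺  = StepCLC⇒StepCLC⁺ (λ ())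
⟶CLC[ suc n ]⇒⟶CLC⁺ = StepCLC⇒StepCLC⁺ (EqClosure.map ⟶CLC[ n ]⇒⟶CLC⁺)

⟶₀⇒⟶CLC[1] : _⟶₀_ ⇒ ⟶CLC[ 1 ]
⟶₀⇒⟶CLC[1] (CT x y)   = CT x y
⟶₀⇒⟶CLC[1] (CF x y)   = CF x y
⟶₀⇒⟶CLC[1] (Cxx z x)  = Ceq z x x (EqClosure.reflexive _)
⟶₀⇒⟶CLC[1] (Kr x y)   = Kr x y
⟶₀⇒⟶CLC[1] (Sr x y z) = Sr x y z
⟶₀⇒⟶CLC[1] (appL c s) = appL c (⟶₀⇒⟶CLC[1] s)
⟶₀⇒⟶CLC[1] (appR c s) = appR c (⟶₀⇒⟶CLC[1] s)

=CLC₀⇒=CLC : _=CLC₀_ ⇒ _=CLC_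
=CLC₀⇒=CLC = EqClosure.map (λ s → 1 , ⟶₀⇒⟶CLC[1] s)

=CLC⇒=CLC⁺ : _=CLC_ ⇒ _=CLC⁺_
=CLC⇒=CLC⁺ = EqClosure.map (λ { (n , s) → n , ⟶CLC[ n ]⇒⟶CLC⁺ s })

=CLC⁺⇒=CLC₀ : _=CLC⁺_ ⇒ _=CLC₀_
=CLC⁺⇒=CLC₀ = EqClosure.fold =CLC₀-isEquivalence (λ { (n , s) → ⟶CLC⁺[ n ]⇒=CLC₀ s })

mainTheorem3 : ∀ (q q' : Term) →
    ((q =CLC₀ q') ⇔ (q =CLC q')) × ((q =CLC q') ⇔ (q =CLC⁺ q'))
mainTheorem3 q q' =
  mk⇔ =CLC₀⇒=CLC (λ e → =CLC⁺⇒=CLC₀ (=CLC⇒=CLC⁺ e)) ,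
  mk⇔ =CLC⇒=CLC⁺ (λ e → =CLC₀⇒=CLC (=CLC⁺⇒=CLC₀ e))
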